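{- Let $h\in\{H_{GP},H_{WU}\}$. Then $h$ is monotone increasing (non-decreasing) in its first argument: for all $n\in\mathbb{N}_0$ and all $\mathbf{b}\in\{0,1\}^{\mathbb{N}}$, $h(n,\mathbf{b})\le h(n+1,\mathbf{b})$.
   Context: For an infinite sequence $s=(s_1,s_2,\ldots)$, $\mathrm{ODD}(s)=(s_1,s_3,\ldots)$ and $\mathrm{EVEN}(s)=(s_2,s_4,\ldots)$. For a binary vector $\mathbf{c}$ and a bit $a$, $a\mathbf{c}$ denotes the vector with first entry $a$ followed by $\mathbf{c}$. The function $H_{GP}:\mathbb{N}_0\times\{0,1\}^{\mathbb{N}}\to\mathbb{N}_0$ is defined recursively by $H_{GP}(0,\mathbf{b})=0$ and, for $k>0$, $H_{GP}(k,0\mathbf{c})=1+H_{GP}(k-1,\mathbf{c})$ and $H_{GP}(k,1\mathbf{c})=1+\max\{H_{GP}(\lceil\tfrac{k-1}{2}\rceil,\mathrm{ODD}(\mathbf{c})),\,H_{GP}(\lfloor\tfrac{k-1}{2}\rfloor,\mathrm{EVEN}(\mathbf{c}))\}$. The function $H_{WU}:\mathbb{N}_0\times\{0,1\}^{\mathbb{N}}\to\mathbb{N}_0\cup\{\infty\}$ is defined by $H_{WU}(0,\mathbf{b})=0$; for $k>0$, $H_{WU}(k,\mathbf{0})=\infty$ for the all-zeros vector, and if $\mathbf{b}=0^m1\mathbf{c}$ ($m\ge0$ zeros followed by a one) then $H_{WU}(k,\mathbf{b})=m+1+\max\{H_{WU}(\lceil\tfrac{k-1}{2}\rceil,\mathrm{ODD}(\mathbf{c})),\,H_{WU}(\lfloor\tfrac{k-1}{2}\rfloor,\mathrm{EVEN}(\mathbf{c}))\}$.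 -}

module Defs where

open import Data.Nat using (ℕ; zero; suc; _+_; _*_; _<_; _≤_; _⊔_; ⌊_/2⌋; ⌈_/2⌉)
open import Data.Bool using (Bool; true; false)
open import Data.Product using (_×_; Σ)
open import Relation.Binary.PropositionalEquality using (_≡_)

-- An infinite binary sequence b = (b_1, b_2, ...), stored 0-indexed: b 0 = b_1.
Seq : Set
Seq = ℕ → Bool

dropS : ℕ → Seq → Seq
dropS n s i = s (n + i)

-- ODD(s) = (s_1, s_3, ...) and EVEN(s) = (s_2, s_4, ...)  (1-indexed).
oddS : Seq → Seq
oddS s i = s (2 * i)

evenS : Seq → Seq
evenS s i = s (suc (2 * i))

-- Note: for k > 0, ⌈(k-1)/2⌉ = ⌈ (k-1) /2⌉; writing k = suc k' these are ⌈ k' /2⌉, ⌊ k' /2⌋.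

-- H_GP computed with fuel; the fuel only guarantees termination.
-- hgpF (suc f) k b agrees with the recursive definition whenever k ≤ suc f.
hgpF : ℕ → ℕ → Seq → ℕ
hgpF zero    _       _ = 0
hgpF (suc f) zero    _ = 0
hgpF (suc f) (suc k) b with b 0
... | false = suc (hgpF f k (dropS 1 b))
... | true  = suc (hgpF f ⌈ k /2⌉ (oddS (dropS 1 b)) ⊔ hgpF f ⌊ k /2⌋ (evenS (dropS 1 b)))

-- H_GP(k, b); fuel k suffices since every recursive call has argument ≤ k - 1.
HGP : ℕ → Seq → ℕ
HGP k b = hgpF k k b

-- b = 0^m 1 c : the first 1 of b is at (0-indexed) position m.
FirstOneAt : Seq → ℕ → Set
FirstOneAt b m = (b m ≡ true) × (∀ i → i < m → b i ≡ false)

-- Graph of H_WU restricted to finite values: HWU k b v  iff  H_WU(k,b) = v ∈ ℕ.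
-- H_WU(k,b) = ∞ exactly when there is no v with HWU k b v.
data HWU : ℕ → Seq → ℕ → Set where
  hwu-zero : ∀ b → HWU zero b zero
  hwu-step : ∀ k b m v₁ v₂ → FirstOneAt b m →
             HWU ⌈ k /2⌉ (oddS  (dropS (suc m) b)) v₁ →
             HWU ⌊ k /2⌋ (evenS (dropS (suc m) b)) v₂ →
             HWU (suc k) b (m + 1 + (v₁ ⊔ v₂))

-- H_WU(n,b) ≤ H_WU(n',b) in ℕ ∪ {∞}: if the right side is finite (= v'),
-- then the left side is finite with value ≤ v'.
HWU-≤ : ℕ → ℕ → Seq → Set
HWU-≤ n n' b = ∀ v' → HWU n' b v' → Σ ℕ (λ v → HWU n b v × (v ≤ v'))

module Submission where

-- The proof is the same induction for both functions: the recursion on the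
-- first argument is driven by the same bits of b for k and k' (the bit b₁, or
-- the position m of the first one), and the recursive arguments ⌈(k-1)/2⌉ and
-- ⌊(k-1)/2⌋ are monotone in k, so the recursive values compare by induction
-- and 1 + max (resp. m + 1 + max) preserves the order.

open import Defs
open import Data.Nat using (ℕ; zero; suc; _≤_; _≤′_; ≤′-refl; ≤′-step; _+_; _⊔_; z≤n; s≤s; ⌊_/2⌋; ⌈_/2⌉)
open import Data.Nat.Properties
  using (≤-refl; ≤-trans; ≤⇒≤′; ≤′⇒≤; n≤1+n; ⊔-mono-≤; +-monoʳ-≤; ⌈n/2⌉≤n; ⌊n/2⌋≤n; ⌈n/2⌉-mono; ⌊n/2⌋-mono)
open import Data.Bool using (true; false)
open import Data.Product using (_×_; _,_; Σ)
open import Relation.Binary.PropositionalEquality using (_≡_; refl; cong; cong₂; trans)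

hgpF-fuel-stable : ∀ f k b → k ≤ f → hgpF f k b ≡ hgpF (suc f) k b
hgpF-fuel-stable zero    zero    b _ = refl
hgpF-fuel-stable (suc f) zero    b _ = refl
hgpF-fuel-stable (suc f) (suc k) b (s≤s k≤f) with b 0
... | false = cong suc (hgpF-fuel-stable f k _ k≤f)
... | true  = cong suc (cong₂ _⊔_
  (hgpF-fuel-stable f ⌈ k /2⌉ _ (≤-trans (⌈n/2⌉≤n k) k≤f))
  (hgpF-fuel-stable f ⌊ k /2⌋ _ (≤-trans (⌊n/2⌋≤n k) k≤f)))

hgpF-mono : ∀ f k k' b → k ≤ k' → k' ≤ f → hgpF f k b ≤ hgpF f k' b
hgpF-mono zero    k       k'       b _           _ = z≤n
hgpF-mono (suc f) zero    k'       b _           _ = z≤n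
hgpF-mono (suc f) (suc k) (suc k') b (s≤s k≤k') (s≤s k'≤f) with b 0
... | false = s≤s (hgpF-mono f k k' _ k≤k' k'≤f)
... | true  = s≤s (⊔-mono-≤
  (hgpF-mono f _ _ _ (⌈n/2⌉-mono k≤k') (≤-trans (⌈n/2⌉≤n k') k'≤f))
  (hgpF-mono f _ _ _ (⌊n/2⌋-mono k≤k') (≤-trans (⌊n/2⌋≤n k') k'≤f)))

hgpF-fuel-irrelevant : ∀ {k f} b → k ≤′ f → HGP k b ≡ hgpF f k b
hgpF-fuel-irrelevant b ≤′-refl = refl
hgpF-fuel-irrelevant {k} {suc f} b (≤′-step k≤′f) =
  trans (hgpF-fuel-irrelevant b k≤′f) (hgpF-fuel-stable f k b (≤′⇒≤ k≤′f))

-- H_GP(k,b) ≤ H_GP(k',b) whenever k ≤ k': evaluate the left side with the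
-- fuel k' of the right side, then compare at that common fuel.
hgp-mono : ∀ {k k'} b → k ≤ k' → HGP k b ≤ HGP k' b
hgp-mono {k} {k'} b k≤k' rewrite hgpF-fuel-irrelevant b (≤⇒≤′ k≤k') =
  hgpF-mono k' k k' b k≤k' ≤-refl

-- H_WU(k,b) ≤ H_WU(k',b) in ℕ ∪ {∞} whenever k ≤ k': by induction on the
-- derivation of the finite value at k', reusing the same first one (position
-- m) of b at k and comparing the halved arguments recursively.
hwu-mono : ∀ {k k'} b → k ≤ k' → HWU-≤ k k' b
hwu-mono b z≤n _ _ = zero , hwu-zero b , z≤n
hwu-mono b (s≤s k≤k') _ (hwu-step k' .b m v₁ v₂ firstOne odd-value even-value)
  with hwu-mono _ (⌈n/2⌉-mono k≤k') v₁ odd-value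
     | hwu-mono _ (⌊n/2⌋-mono k≤k') v₂ even-value
... | w₁ , odd-value' , w₁≤v₁ | w₂ , even-value' , w₂≤v₂ =
  m + 1 + (w₁ ⊔ w₂) ,
  hwu-step _ b m w₁ w₂ firstOne odd-value' even-value' ,
  +-monoʳ-≤ (m + 1) (⊔-mono-≤ w₁≤v₁ w₂≤v₂)

lemma8 : (∀ (n : ℕ) (b : Seq) → HGP n b ≤ HGP (suc n) b)
         × (∀ (n : ℕ) (b : Seq) → HWU-≤ n (suc n) b)
lemma8 = (λ n b → hgp-mono b (n≤1+n n)) , (λ n b → hwu-mono b (n≤1+n n))
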